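{- Let $t$ be a meadow term over the signature $(0,1,+,\cdot,-,{}^{ -1})$ whose variables are input variables among $x_0,\dots,x_k$. Then $t$ can be computed by a finite, test-free thread $T$ that uses 5 auxiliary variables; that is, for all cancellation meadows $\mathcal{M}$ and all $m_0,\dots,m_k\in\mathcal{M}$, $[\![T]\!]^k_{\mathcal{M}}(m_0,\dots,m_k)$ equals the value of $t$ in $\mathcal{M}$ under $x_i\mapsto m_i$.
   Context: A meadow is a commutative ring with unit with a total unary operation $x\mapsto x^{ -1}$ satisfying $(x^{ -1})^{ -1}=x$ and $x\cdot(x\cdot x^{ -1})=x$. A cancellation meadow is a meadow additionally satisfying $x\neq0\rightarrow x\cdot x^{ -1}=1$. Variables: input $x_0,x_1,\dots$, auxiliary $a_0,a_1,\dots$, output $y$. Actions (for auxiliary $a,a'$, input $x$): assignments $a.\mathtt{cp}(x)$ ($a:=x$), $a.\mathtt{set{:}0}$, $a.\mathtt{set{:}1}$, $a.\mathtt{set{:}ai}$ ($a:=-a$), $a.\mathtt{set{:}mi}$ ($a:=a^{ -1}$), $a.\mathtt{set{:}a}(a')$ ($a:=a+a'$), $a.\mathtt{set{:}m}(a')$ ($a:=a\cdot a'$), $y.\mathtt{cp}(a)$ ($y:=a$), always replying $\mathtt{true}$; and the test $a.\mathtt{test{:}0}$, replying $\mathtt{true}$ iff the value of $a$ is $0$. Finite threads: $\mathsf{S}$ (termination), $\mathsf{D}$ (deadlock), $T_1\trianglelefteq\mathtt{a}\trianglerighteq T_2$ (perform action $\mathtt{a}$, continue as $T_1$ on reply $\mathtt{true}$,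 as $T_2$ on $\mathtt{false}$); $\mathtt{a}\circ T$ abbreviates $T\trianglelefteq\mathtt{a}\trianglerighteq T$. A thread is test-free if postconditional composition occurs in it only in the form $\mathtt{a}\circ T$. A thread uses $n$ auxiliary variables if the auxiliary variables occurring in its actions are precisely $a_0,\dots,a_{n-1}$. For a meadow $\mathcal{M}$, $[\![T]\!]^k_{\mathcal{M}}(m_0,\dots,m_k)$ is the value of $y$ after running $T$ (assignments update the state, tests branch on whether the tested variable is $0$) from the state with $x_i=m_i$ for $i\le k$ and all other variables $0$, if the run ends in $\mathsf{S}$, and undefined otherwise. -}

module Defs where

open import Level using (Level; _⊔_; Setω)
open import Data.Nat using (ℕ; _<_; _≤_; _≟_; _<?_)
open import Data.Unit using (⊤)
open import Data.Empty using (⊥)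
open import Data.Fin using (Fin; fromℕ<)
open import Data.Product using (_×_; Σ; ∃; _,_)
open import Data.Sum using (_⊎_)
open import Function.Bundles using (_⇔_)
open import Relation.Nullary using (¬_; yes; no)
open import Relation.Binary.PropositionalEquality using (_≡_)
open import Algebra.Bundles using (CommutativeRing)

record Meadow (c ℓ : Level) : Set (Level.suc (c ⊔ ℓ)) where
  field
    commutativeRing : CommutativeRing c ℓ
  open CommutativeRing commutativeRing public
  field
    _⁻¹      : Carrier → Carrier
    ⁻¹-cong  : ∀ {x y} → x ≈ y → x ⁻¹ ≈ y ⁻¹
    ⁻¹-invol : ∀ x → (x ⁻¹) ⁻¹ ≈ x
    ril      : ∀ x → x * (x * x ⁻¹) ≈ x

IsCancellationMeadow : ∀ {c ℓ} → Meadow c ℓ → Set (c ⊔ ℓ)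
IsCancellationMeadow M = ∀ x → ¬ (x ≈ 0#) → x * (x ⁻¹) ≈ 1#
  where open Meadow M

data Term (n : ℕ) : Set where
  var  : Fin n → Term n
  zer  : Term n
  one  : Term n
  _⊕_  : Term n → Term n → Term n
  _⊗_  : Term n → Term n → Term n
  ⊝_   : Term n → Term n
  _ᴵ   : Term n → Term n

eval : ∀ {c ℓ n} (M : Meadow c ℓ) → (Fin n → Meadow.Carrier M) → Term n → Meadow.Carrier M
eval M ρ (var i) = ρ i
eval M ρ zer     = Meadow.0# M
eval M ρ one     = Meadow.1# M
eval M ρ (s ⊕ u) = Meadow._+_ M (eval M ρ s) (eval M ρ u)
eval M ρ (s ⊗ u) = Meadow._*_ M (eval M ρ s) (eval M ρ u)
eval M ρ (⊝ s)   = Meadow.-_ M (eval M ρ s)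
eval M ρ (s ᴵ)   = Meadow._⁻¹ M (eval M ρ s)

data Action : Set where
  cp     : ℕ → ℕ → Action      -- cp a j     : a_a := x_j
  set0   : ℕ → Action
  set1   : ℕ → Action
  setai  : ℕ → Action
  setmi  : ℕ → Action
  seta   : ℕ → ℕ → Action      -- seta a a'  : a := a + a'
  setm   : ℕ → ℕ → Action      -- setm a a'  : a := a · a'
  ycp    : ℕ → Action
  test0  : ℕ → Action

data Thread : Set where
  S    : Thread
  D    : Thread
  _⊴_⊵_ : Thread → Action → Thread → Thread

_∘ₜ_ : Action → Thread → Thread
a ∘ₜ T = T ⊴ a ⊵ T

data TestFree : Thread → Set where
  S-tf : TestFree S
  D-tf : TestFree D
  ∘-tf : ∀ a T → TestFree T → TestFree (a ∘ₜ T)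

data AuxInAction (i : ℕ) : Action → Set where
  cp-o     : ∀ j → AuxInAction i (cp i j)
  set0-o   : AuxInAction i (set0 i)
  set1-o   : AuxInAction i (set1 i)
  setai-o  : AuxInAction i (setai i)
  setmi-o  : AuxInAction i (setmi i)
  seta-o₁  : ∀ b → AuxInAction i (seta i b)
  seta-o₂  : ∀ b → AuxInAction i (seta b i)
  setm-o₁  : ∀ b → AuxInAction i (setm i b)
  setm-o₂  : ∀ b → AuxInAction i (setm b i)
  ycp-o    : AuxInAction i (ycp i)
  test0-o  : AuxInAction i (test0 i)

data AuxInThread (i : ℕ) : Thread → Set where
  here  : ∀ {T₁ a T₂} → AuxInAction i a → AuxInThread i (T₁ ⊴ a ⊵ T₂)
  left  : ∀ {T₁ a T₂} → AuxInThread i T₁ → AuxInThread i (T₁ ⊴ a ⊵ T₂)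
  right : ∀ {T₁ a T₂} → AuxInThread i T₂ → AuxInThread i (T₁ ⊴ a ⊵ T₂)

UsesAux : ℕ → Thread → Set
UsesAux n T = ∀ i → AuxInThread i T ⇔ i < n

module Semantics {c ℓ} (M : Meadow c ℓ) where
  open Meadow M

  record State : Set c where
    constructor st
    field
      xs  : ℕ → Carrier
      as  : ℕ → Carrier
      yv  : Carrier
  open State public

  upd : (ℕ → Carrier) → ℕ → Carrier → (ℕ → Carrier)
  upd f i v j with j ≟ i
  ... | yes _ = v
  ... | no  _ = f j

  effect : Action → State → State
  effect (cp a j)   σ = st (xs σ) (upd (as σ) a (xs σ j)) (yv σ)
  effect (set0 a)   σ = st (xs σ) (upd (as σ) a 0#) (yv σ)
  effect (set1 a)   σ = st (xs σ) (upd (as σ) a 1#) (yv σ)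
  effect (setai a)  σ = st (xs σ) (upd (as σ) a (- as σ a)) (yv σ)
  effect (setmi a)  σ = st (xs σ) (upd (as σ) a (as σ a ⁻¹)) (yv σ)
  effect (seta a b) σ = st (xs σ) (upd (as σ) a (as σ a + as σ b)) (yv σ)
  effect (setm a b) σ = st (xs σ) (upd (as σ) a (as σ a * as σ b)) (yv σ)
  effect (ycp a)    σ = st (xs σ) (as σ) (as σ a)
  effect (test0 a)  σ = σ

  IsTest : Action → Set
  IsTest (test0 _) = ⊤
  IsTest _         = ⊥

  data Run : Thread → State → State → Set (c ⊔ ℓ) where
    run-S     : ∀ {σ} → Run S σ σ
    run-assign : ∀ {T₁ a T₂ σ σ'} → ¬ IsTest a →
                 Run T₁ (effect a σ) σ' → Run (T₁ ⊴ a ⊵ T₂) σ σ'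
    run-test-true  : ∀ {T₁ i T₂ σ σ'} → as σ i ≈ 0# →
                     Run T₁ σ σ' → Run (T₁ ⊴ test0 i ⊵ T₂) σ σ'
    run-test-false : ∀ {T₁ i T₂ σ σ'} → ¬ (as σ i ≈ 0#) →
                     Run T₂ σ σ' → Run (T₁ ⊴ test0 i ⊵ T₂) σ σ'

  initial : (k : ℕ) → (Fin (ℕ.suc k) → Carrier) → State
  initial k m = st xinit (λ _ → 0#) 0#
    where
      xinit : ℕ → Carrier
      xinit j with j <? ℕ.suc k
      ... | yes p = m (fromℕ< p)
      ... | no  _ = 0#

  _⟦_⟧_≃_ : (k : ℕ) → Thread → (Fin (ℕ.suc k) → Carrier) → Carrier → Set (c ⊔ ℓ)
  k ⟦ T ⟧ m ≃ v = Σ State λ σ' → Run T (initial k m) σ' × yv σ' ≈ v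

record ComputedBy (k n : ℕ) (t : Term (ℕ.suc k)) : Setω where
  field
    thread   : Thread
    testFree : TestFree thread
    uses     : UsesAux n thread
    correct  : ∀ {c ℓ} (M : Meadow c ℓ) → IsCancellationMeadow M →
               (m : Fin (ℕ.suc k) → Meadow.Carrier M) →
               Semantics._⟦_⟧_≃_ M k thread m (eval M m t)

-- Every meadow term equals a finite sum of fractions p · q⁻¹ of polynomials: sums, products
-- and negatives of such sums are again such sums, and the inverse of a sum is expanded one
-- fraction at a time by the meadow identity (a q⁻¹ + b)⁻¹ = q (a + q b)⁻¹ + (1 - q q⁻¹) b⁻¹.
-- Such a sum is computed with five registers and no tests: a polynomial is multiplied into a
-- register by a multiply-accumulate program a_j := a_j + p · a_i that needs one temporary,
-- restored at the end, and one scratch register; each denominator is accumulated into a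
-- register, inverted there, and multiplied by its numerator into the running sum.
module Submission where

open import Level using (Level; 0ℓ; _⊔_)
open import Defs
open import Algebra.Bundles using (CommutativeRing; RawRing)
open import Algebra.Solver.Ring.AlmostCommutativeRing
  using (_-Raw-AlmostCommutative⟶_; fromCommutativeRing)
open import Data.Nat using (ℕ; zero; suc; _<_; s≤s) renaming (_+_ to _+ℕ_; _*_ to _*ℕ_)
import Data.Nat.Properties as ℕ
open import Data.Maybe using (Maybe; just; nothing)
open import Data.Product using (_×_; _,_; proj₁; proj₂)
open import Data.Fin as Fin using (Fin; toℕ; #_)
open import Data.Fin.Properties using (toℕ-injective; toℕ<n; fromℕ<-toℕ)
open import Data.Empty using (⊥-elim)
open import Function using (_∘_)
open import Data.List using (List; []; _∷_; _++_; map; concatMap; cartesianProductWith; foldr)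
open import Data.Product.Properties using (≡-dec)
open import Relation.Binary.PropositionalEquality as ≡ using (_≡_; _≢_; ≢-sym)
open import Relation.Nullary using (¬_; yes; no)
open import Function.Bundles using (mk⇔)

-- Integers as differences a − b of naturals, normalised so that one side is zero;
-- normal forms are what lets the ring solver detect cancelling coefficients.
module IntegerCoefficients where

  Diff : Set
  Diff = ℕ × ℕ

  normalise : ℕ → ℕ → Diff
  normalise (suc a) (suc b) = normalise a b
  normalise a       b       = a , b

  +-*-rawRing : RawRing 0ℓ 0ℓ
  +-*-rawRing = record
    { Carrier = Diff
    ; _≈_     = _≡_
    ; _+_     = λ (a , b) (c , d) → normalise (a +ℕ c) (b +ℕ d)
    ; _*_     = λ (a , b) (c , d) → normalise (a *ℕ c +ℕ b *ℕ d) (a *ℕ d +ℕ b *ℕ c)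
    ; -_      = λ (a , b) → b , a
    ; 0#      = 0 , 0
    ; 1#      = 1 , 0
    }

module IntegerSolver {c ℓ : Level} (R : CommutativeRing c ℓ) where

  open CommutativeRing R hiding (zero)
  open import Algebra.Properties.Ring ring using (-0#≈0#; x[y-z]≈xy-xz; -‿distribˡ-*)
  open import Algebra.Properties.AbelianGroup +-abelianGroup using (⁻¹-anti-homo‿-; ⁻¹-∙-comm)
  open import Algebra.Properties.CommutativeSemigroup +-commutativeSemigroup using (interchange)
  open import Algebra.Properties.Semiring.Mult.TCOptimised semiring using (×-homo-+; ×1-homo-*)
    renaming (_×_ to _·_)
  open import Relation.Binary.Reasoning.Setoid setoid
  open IntegerCoefficients

  -- By cases, so that the solver constants con (0 , 0) and con (1 , 0) are 0# and 1# definitionally.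
  ⟦_⟧ : Diff → Carrier
  ⟦ a , zero  ⟧ = a · 1#
  ⟦ a , suc b ⟧ = a · 1# - suc b · 1#

  ⟦⟧-difference : ∀ a b → ⟦ a , b ⟧ ≈ a · 1# - b · 1#
  ⟦⟧-difference a zero    = sym (trans (+-congˡ -0#≈0#) (+-identityʳ _))
  ⟦⟧-difference a (suc b) = refl

  [x+y]-[u+v]≈[x-u]+[y-v] : ∀ x y u v → (x + y) - (u + v) ≈ (x - u) + (y - v)
  [x+y]-[u+v]≈[x-u]+[y-v] x y u v = trans (+-congˡ (sym (⁻¹-∙-comm u v))) (interchange x y (- u) (- v))

  [ac+bd]-[ad+bc]≈[a-b][c-d] : ∀ a b c d → (a * c + b * d) - (a * d + b * c) ≈ (a - b) * (c - d)
  [ac+bd]-[ad+bc]≈[a-b][c-d] a b c d = begin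
    (a * c + b * d) - (a * d + b * c)    ≈⟨ [x+y]-[u+v]≈[x-u]+[y-v] _ _ _ _ ⟩
    (a * c - a * d) + (b * d - b * c)    ≈⟨ +-cong (sym (x[y-z]≈xy-xz a c d)) (sym (⁻¹-anti-homo‿- (b * c) (b * d))) ⟩
    a * (c - d) + - (b * c - b * d)      ≈⟨ +-congˡ (-‿cong (sym (x[y-z]≈xy-xz b c d))) ⟩
    a * (c - d) + - (b * (c - d))        ≈⟨ +-congˡ (-‿distribˡ-* b (c - d)) ⟩
    a * (c - d) + - b * (c - d)          ≈⟨ sym (distribʳ _ _ _) ⟩
    (a - b) * (c - d)                    ∎

  normalise-correct : ∀ a b → ⟦ normalise a b ⟧ ≈ a · 1# - b · 1#
  normalise-correct (suc a) (suc b) = begin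
    ⟦ normalise a b ⟧                              ≈⟨ normalise-correct a b ⟩
    a · 1# - b · 1#                                ≈⟨ sym (+-identityˡ _) ⟩
    0# + (a · 1# - b · 1#)                         ≈⟨ +-congʳ (sym (-‿inverseʳ 1#)) ⟩
    (1# - 1#) + (a · 1# - b · 1#)                  ≈⟨ sym ([x+y]-[u+v]≈[x-u]+[y-v] _ _ _ _) ⟩
    (1# + a · 1#) - (1# + b · 1#)                  ≈⟨ sym (+-cong (×-homo-+ 1# 1 a) (-‿cong (×-homo-+ 1# 1 b))) ⟩
    suc a · 1# - suc b · 1#                        ∎
  normalise-correct zero    b       = ⟦⟧-difference zero b
  normalise-correct (suc a) zero    = ⟦⟧-difference (suc a) zero

  homomorphism : +-*-rawRing -Raw-AlmostCommutative⟶ fromCommutativeRing R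
  homomorphism = record
    { ⟦_⟧    = ⟦_⟧
    ; +-homo = λ (a , b) (c , d) → begin
        ⟦ normalise (a +ℕ c) (b +ℕ d) ⟧                ≈⟨ normalise-correct (a +ℕ c) (b +ℕ d) ⟩
        (a +ℕ c) · 1# - (b +ℕ d) · 1#                  ≈⟨ +-cong (×-homo-+ 1# a c) (-‿cong (×-homo-+ 1# b d)) ⟩
        (a · 1# + c · 1#) - (b · 1# + d · 1#)          ≈⟨ [x+y]-[u+v]≈[x-u]+[y-v] _ _ _ _ ⟩
        (a · 1# - b · 1#) + (c · 1# - d · 1#)          ≈⟨ sym (+-cong (⟦⟧-difference a b) (⟦⟧-difference c d)) ⟩
        ⟦ a , b ⟧ + ⟦ c , d ⟧                          ∎
    ; *-homo = λ (a , b) (c , d) → begin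
        ⟦ normalise (a *ℕ c +ℕ b *ℕ d) (a *ℕ d +ℕ b *ℕ c) ⟧   ≈⟨ normalise-correct (a *ℕ c +ℕ b *ℕ d) (a *ℕ d +ℕ b *ℕ c) ⟩
        (a *ℕ c +ℕ b *ℕ d) · 1# - (a *ℕ d +ℕ b *ℕ c) · 1#      ≈⟨ +-cong (×-homo-+ 1# (a *ℕ c) (b *ℕ d)) (-‿cong (×-homo-+ 1# (a *ℕ d) (b *ℕ c))) ⟩
        ((a *ℕ c) · 1# + (b *ℕ d) · 1#) - ((a *ℕ d) · 1# + (b *ℕ c) · 1#)
          ≈⟨ +-cong (+-cong (×1-homo-* a c) (×1-homo-* b d)) (-‿cong (+-cong (×1-homo-* a d) (×1-homo-* b c))) ⟩
        (a · 1# * c · 1# + b · 1# * d · 1#) - (a · 1# * d · 1# + b · 1# * c · 1#)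
          ≈⟨ [ac+bd]-[ad+bc]≈[a-b][c-d] _ _ _ _ ⟩
        (a · 1# - b · 1#) * (c · 1# - d · 1#)           ≈⟨ sym (*-cong (⟦⟧-difference a b) (⟦⟧-difference c d)) ⟩
        ⟦ a , b ⟧ * ⟦ c , d ⟧                           ∎
    ; -‿homo = λ (a , b) → begin
        ⟦ b , a ⟧                ≈⟨ ⟦⟧-difference b a ⟩
        b · 1# - a · 1#          ≈⟨ sym (⁻¹-anti-homo‿- _ _) ⟩
        - (a · 1# - b · 1#)      ≈⟨ -‿cong (sym (⟦⟧-difference a b)) ⟩
        - ⟦ a , b ⟧              ∎
    ; 0-homo = refl
    ; 1-homo = refl
    }

  coefficient-≟ : ∀ x y → Maybe (⟦ x ⟧ ≈ ⟦ y ⟧)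
  coefficient-≟ x y with ≡-dec ℕ._≟_ ℕ._≟_ x y
  ... | yes ≡.refl = just refl
  ... | no  _      = nothing

  open import Algebra.Solver.Ring +-*-rawRing (fromCommutativeRing R) homomorphism coefficient-≟
    public using (solve; _:=_; _:+_; _:-_; _:*_; :-_; con)

module MeadowProperties {c ℓ : Level} (M : Meadow c ℓ) where

  open Meadow M
  open IntegerSolver commutativeRing
  open import Relation.Binary.Reasoning.Setoid setoid

  1⁻¹≈1 : 1# ⁻¹ ≈ 1#
  1⁻¹≈1 = trans (sym (trans (*-identityˡ _) (*-identityˡ _))) (ril 1#)

  ril⁻¹ : ∀ x → x ⁻¹ * (x ⁻¹ * x) ≈ x ⁻¹
  ril⁻¹ x = trans (*-congˡ (*-congˡ (sym (⁻¹-invol x)))) (ril (x ⁻¹))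

  ⁻¹-unique : ∀ x y → x * (x * y) ≈ x → y * (y * x) ≈ y → y ≈ x ⁻¹
  ⁻¹-unique x y xxy≈x yyx≈y = begin
    y                     ≈⟨ yyx≈y ⟨
    y * (y * x)           ≈⟨ solve 2 (λ x y → y :* (y :* x) := (x :* y) :* y) refl x y ⟩
    (x * y) * y           ≈⟨ *-congʳ xy≈xx⁻¹ ⟩
    (x * x ⁻¹) * y        ≈⟨ solve 3 (λ x y u → (x :* u) :* y := u :* (x :* y)) refl x y (x ⁻¹) ⟩
    x ⁻¹ * (x * y)        ≈⟨ *-congˡ xy≈xx⁻¹ ⟩
    x ⁻¹ * (x * x ⁻¹)     ≈⟨ *-congˡ (*-comm _ _) ⟩
    x ⁻¹ * (x ⁻¹ * x)     ≈⟨ ril⁻¹ x ⟩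
    x ⁻¹                  ∎
    where
    xy≈xx⁻¹ : x * y ≈ x * x ⁻¹
    xy≈xx⁻¹ = begin
      x * y                  ≈⟨ *-congʳ (ril x) ⟨
      x * (x * x ⁻¹) * y     ≈⟨ solve 3 (λ x y u → x :* (x :* u) :* y := x :* (x :* y) :* u) refl x y (x ⁻¹) ⟩
      x * (x * y) * x ⁻¹     ≈⟨ *-congʳ xxy≈x ⟩
      x * x ⁻¹               ∎

  ⁻¹-homo-* : ∀ x y → (x * y) ⁻¹ ≈ x ⁻¹ * y ⁻¹
  ⁻¹-homo-* x y = sym (⁻¹-unique (x * y) (x ⁻¹ * y ⁻¹) xy-side inverse-side)
    where
    xy-side : x * y * (x * y * (x ⁻¹ * y ⁻¹)) ≈ x * y
    xy-side = trans (solve 4 (λ x y u v → x :* y :* (x :* y :* (u :* v)) := x :* (x :* u) :* (y :* (y :* v)))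
                        refl x y (x ⁻¹) (y ⁻¹))
                 (*-cong (ril x) (ril y))
    inverse-side : x ⁻¹ * y ⁻¹ * (x ⁻¹ * y ⁻¹ * (x * y)) ≈ x ⁻¹ * y ⁻¹
    inverse-side = trans (solve 4 (λ x y u v → u :* v :* (u :* v :* (x :* y)) := u :* (u :* x) :* (v :* (v :* y)))
                         refl x y (x ⁻¹) (y ⁻¹))
                  (*-cong (ril⁻¹ x) (ril⁻¹ y))

  e*e≈e⇒e⁻¹≈e : ∀ e → e * e ≈ e → e ⁻¹ ≈ e
  e*e≈e⇒e⁻¹≈e e ee≈e = sym (⁻¹-unique e e eee≈e eee≈e)
    where
    eee≈e : e * (e * e) ≈ e
    eee≈e = trans (*-congˡ ee≈e) ee≈e

  e*e≈e⇒e*x⁻¹≈[e*x]⁻¹ : ∀ e x → e * e ≈ e → e * x ⁻¹ ≈ (e * x) ⁻¹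
  e*e≈e⇒e*x⁻¹≈[e*x]⁻¹ e x ee≈e = trans (*-congʳ (sym (e*e≈e⇒e⁻¹≈e e ee≈e))) (sym (⁻¹-homo-* e x))

  [xx⁻¹]²≈xx⁻¹ : ∀ x → (x * x ⁻¹) * (x * x ⁻¹) ≈ x * x ⁻¹
  [xx⁻¹]²≈xx⁻¹ x = trans (solve 2 (λ x u → (x :* u) :* (x :* u) := x :* (x :* u) :* u) refl x (x ⁻¹))
                         (*-congʳ (ril x))

  [1-xx⁻¹]²≈1-xx⁻¹ : ∀ x → (1# - x * x ⁻¹) * (1# - x * x ⁻¹) ≈ 1# - x * x ⁻¹
  [1-xx⁻¹]²≈1-xx⁻¹ x = begin
    (1# - o) * (1# - o)       ≈⟨ solve 1 (λ o → (con (1 , 0) :- o) :* (con (1 , 0) :- o) := con (1 , 0) :- o :- o :+ o :* o) refl o ⟩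
    1# - o - o + o * o        ≈⟨ +-congˡ ([xx⁻¹]²≈xx⁻¹ x) ⟩
    1# - o - o + o            ≈⟨ solve 1 (λ o → con (1 , 0) :- o :- o :+ o := con (1 , 0) :- o) refl o ⟩
    1# - o                    ∎
    where o = x * x ⁻¹

  [1-xx⁻¹]x⁻¹≈0 : ∀ x → (1# - x * x ⁻¹) * x ⁻¹ ≈ 0#
  [1-xx⁻¹]x⁻¹≈0 x = begin
    (1# - x * x ⁻¹) * x ⁻¹        ≈⟨ solve 2 (λ x u → (con (1 , 0) :- x :* u) :* u := u :- u :* (u :* x)) refl x (x ⁻¹) ⟩
    x ⁻¹ - x ⁻¹ * (x ⁻¹ * x)     ≈⟨ +-congˡ (-‿cong (ril⁻¹ x)) ⟩
    x ⁻¹ - x ⁻¹                  ≈⟨ -‿inverseʳ _ ⟩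
    0#                           ∎

  -- Splitting along the idempotents q q⁻¹ and 1 - q q⁻¹: on the first q⁻¹ may be
  -- cleared from the denominator, on the second q⁻¹ vanishes.
  [aq⁻¹+b]⁻¹≈q[a+qb]⁻¹+[1-qq⁻¹]b⁻¹ : ∀ a q b →
    (a * q ⁻¹ + b) ⁻¹ ≈ q * (a + q * b) ⁻¹ + (1# - q * q ⁻¹) * b ⁻¹
  [aq⁻¹+b]⁻¹≈q[a+qb]⁻¹+[1-qq⁻¹]b⁻¹ a q b = begin
    L                                  ≈⟨ solve 2 (λ L o → L := o :* L :+ (con (1 , 0) :- o) :* L) refl L o ⟩
    o * L + z * L                      ≈⟨ +-cong o-part z-part ⟩
    q * (a + q * b) ⁻¹ + z * b ⁻¹      ∎
    where
    o = q * q ⁻¹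
    z = 1# - o
    L = (a * q ⁻¹ + b) ⁻¹

    z-part : z * L ≈ z * b ⁻¹
    z-part = begin
      z * L                         ≈⟨ e*e≈e⇒e*x⁻¹≈[e*x]⁻¹ z _ ([1-xx⁻¹]²≈1-xx⁻¹ q) ⟩
      (z * (a * q ⁻¹ + b)) ⁻¹       ≈⟨ ⁻¹-cong (solve 4 (λ z a u b → z :* (a :* u :+ b) := a :* (z :* u) :+ z :* b) refl z a (q ⁻¹) b) ⟩
      (a * (z * q ⁻¹) + z * b) ⁻¹   ≈⟨ ⁻¹-cong (+-congʳ (trans (*-congˡ ([1-xx⁻¹]x⁻¹≈0 q)) (zeroʳ a))) ⟩
      (0# + z * b) ⁻¹               ≈⟨ ⁻¹-cong (+-identityˡ _) ⟩
      (z * b) ⁻¹                    ≈⟨ e*e≈e⇒e*x⁻¹≈[e*x]⁻¹ z b ([1-xx⁻¹]²≈1-xx⁻¹ q) ⟨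
      z * b ⁻¹                      ∎

    o-part : o * L ≈ q * (a + q * b) ⁻¹
    o-part = begin
      q * q ⁻¹ * L                   ≈⟨ *-assoc _ _ _ ⟩
      q * (q ⁻¹ * L)                 ≈⟨ *-congˡ (⁻¹-homo-* q _) ⟨
      q * (q * (a * q ⁻¹ + b)) ⁻¹    ≈⟨ *-congˡ (⁻¹-cong q[aq⁻¹+b]≈o[a+qb]) ⟩
      q * (o * (a + q * b)) ⁻¹       ≈⟨ *-congˡ (e*e≈e⇒e*x⁻¹≈[e*x]⁻¹ o _ ([xx⁻¹]²≈xx⁻¹ q)) ⟨
      q * (o * (a + q * b) ⁻¹)       ≈⟨ *-assoc _ _ _ ⟨
      q * o * (a + q * b) ⁻¹         ≈⟨ *-congʳ (ril q) ⟩
      q * (a + q * b) ⁻¹             ∎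
      where
      q[aq⁻¹+b]≈o[a+qb] : q * (a * q ⁻¹ + b) ≈ o * (a + q * b)
      q[aq⁻¹+b]≈o[a+qb] = begin
        q * (a * q ⁻¹ + b)           ≈⟨ solve 4 (λ q u a b → q :* (a :* u :+ b) := q :* u :* a :+ q :* b) refl q (q ⁻¹) a b ⟩
        o * a + q * b                ≈⟨ +-congˡ (*-congʳ (ril q)) ⟨
        o * a + q * o * b            ≈⟨ solve 4 (λ q u a b → q :* u :* a :+ q :* (q :* u) :* b := q :* u :* (a :+ q :* b)) refl q (q ⁻¹) a b ⟩
        o * (a + q * b)              ∎

module SumsOfFractions where

  infixl 6 _⊞_
  infixl 7 _⊠_
  infix  8 ⊟_

  data Polynomial (n : ℕ) : Set where
    input   : Fin n → Polynomial n
    0ₚ 1ₚ   : Polynomial n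
    _⊞_ _⊠_ : Polynomial n → Polynomial n → Polynomial n
    ⊟_      : Polynomial n → Polynomial n

  -- (p , q) stands for p · q⁻¹.
  Fraction : ℕ → Set
  Fraction n = Polynomial n × Polynomial n

  FractionSum : ℕ → Set
  FractionSum n = List (Fraction n)

  module _ {n : ℕ} where

    scale : Polynomial n → FractionSum n → FractionSum n
    scale r = map (λ (p , q) → r ⊠ p , q)

    _⊗ₛ_ : FractionSum n → FractionSum n → FractionSum n
    _⊗ₛ_ = cartesianProductWith (λ (p , q) (p′ , q′) → p ⊠ p′ , q ⊠ q′)

    complement : Polynomial n → FractionSum n
    complement q = (1ₚ , 1ₚ) ∷ (⊟ q , q) ∷ []

    -- A fraction sum for (P + c F)⁻¹: peeling off the head p q⁻¹ of F is the identity
    -- [aq⁻¹+b]⁻¹≈q[a+qb]⁻¹+[1-qq⁻¹]b⁻¹ with a = c p and b = P + c (rest of F).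
    invert : Polynomial n → Polynomial n → FractionSum n → FractionSum n
    invert c P []            = (1ₚ , P) ∷ []
    invert c P ((p , q) ∷ F) =
      scale q (invert (c ⊠ q) (P ⊠ q ⊞ c ⊠ p) F) ++ complement q ⊗ₛ invert c P F

    fractions : Term n → FractionSum n
    fractions (var i) = (input i , 1ₚ) ∷ []
    fractions zer     = []
    fractions one     = (1ₚ , 1ₚ) ∷ []
    fractions (s ⊕ t) = fractions s ++ fractions t
    fractions (s ⊗ t) = fractions s ⊗ₛ fractions t
    fractions (⊝ s)   = scale (⊟ 1ₚ) (fractions s)
    fractions (s ᴵ)   = invert 1ₚ 0ₚ (fractions s)

  module Valuation {c ℓ : Level} (M : Meadow c ℓ) {n : ℕ} (ρ : Fin n → Meadow.Carrier M) where

    open Meadow M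
    open MeadowProperties M
    open IntegerSolver commutativeRing
    open import Algebra.Properties.Ring ring using (-1*x≈-x)
    open import Relation.Binary.Reasoning.Setoid setoid

    ⟦_⟧ₚ : Polynomial n → Carrier
    ⟦ input v ⟧ₚ = ρ v
    ⟦ 0ₚ ⟧ₚ      = 0#
    ⟦ 1ₚ ⟧ₚ      = 1#
    ⟦ p ⊞ q ⟧ₚ   = ⟦ p ⟧ₚ + ⟦ q ⟧ₚ
    ⟦ p ⊠ q ⟧ₚ   = ⟦ p ⟧ₚ * ⟦ q ⟧ₚ
    ⟦ ⊟ p ⟧ₚ     = - ⟦ p ⟧ₚ

    ⟦_⟧f : Fraction n → Carrier
    ⟦ p , q ⟧f = ⟦ p ⟧ₚ * ⟦ q ⟧ₚ ⁻¹

    ⟦_⟧ₛ : FractionSum n → Carrier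
    ⟦ [] ⟧ₛ    = 0#
    ⟦ f ∷ F ⟧ₛ = ⟦ f ⟧f + ⟦ F ⟧ₛ

    ⟦++⟧ : ∀ F G → ⟦ F ++ G ⟧ₛ ≈ ⟦ F ⟧ₛ + ⟦ G ⟧ₛ
    ⟦++⟧ []      G = sym (+-identityˡ _)
    ⟦++⟧ (f ∷ F) G = trans (+-congˡ (⟦++⟧ F G)) (sym (+-assoc _ _ _))

    ⟦map⟧ : ∀ (g : Fraction n → Fraction n) k → (∀ f → ⟦ g f ⟧f ≈ k * ⟦ f ⟧f) →
            ∀ F → ⟦ map g F ⟧ₛ ≈ k * ⟦ F ⟧ₛ
    ⟦map⟧ g k g≈k* []      = sym (zeroʳ k)
    ⟦map⟧ g k g≈k* (f ∷ F) = trans (+-cong (g≈k* f) (⟦map⟧ g k g≈k* F)) (sym (distribˡ _ _ _))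

    ⟦scale⟧ : ∀ r F → ⟦ scale r F ⟧ₛ ≈ ⟦ r ⟧ₚ * ⟦ F ⟧ₛ
    ⟦scale⟧ r = ⟦map⟧ _ ⟦ r ⟧ₚ (λ (p , q) → *-assoc _ _ _)

    ⟦⊗ₛ⟧ : ∀ F G → ⟦ F ⊗ₛ G ⟧ₛ ≈ ⟦ F ⟧ₛ * ⟦ G ⟧ₛ
    ⟦⊗ₛ⟧ []            G = sym (zeroˡ _)
    ⟦⊗ₛ⟧ ((p , q) ∷ F) G = begin
      ⟦ map _ G ++ F ⊗ₛ G ⟧ₛ                  ≈⟨ ⟦++⟧ (map _ G) (F ⊗ₛ G) ⟩
      ⟦ map _ G ⟧ₛ + ⟦ F ⊗ₛ G ⟧ₛ              ≈⟨ +-cong (⟦map⟧ _ ⟦ p , q ⟧f ⟦⊡⟧ G) (⟦⊗ₛ⟧ F G) ⟩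
      ⟦ p , q ⟧f * ⟦ G ⟧ₛ + ⟦ F ⟧ₛ * ⟦ G ⟧ₛ   ≈⟨ distribʳ _ _ _ ⟨
      (⟦ p , q ⟧f + ⟦ F ⟧ₛ) * ⟦ G ⟧ₛ          ∎
      where
      ⟦⊡⟧ : ∀ g → ⟦ p ⊠ proj₁ g , q ⊠ proj₂ g ⟧f ≈ ⟦ p , q ⟧f * ⟦ g ⟧f
      ⟦⊡⟧ (p′ , q′) = begin
        ⟦ p ⟧ₚ * ⟦ p′ ⟧ₚ * (⟦ q ⟧ₚ * ⟦ q′ ⟧ₚ) ⁻¹        ≈⟨ *-congˡ (⁻¹-homo-* _ _) ⟩
        ⟦ p ⟧ₚ * ⟦ p′ ⟧ₚ * (⟦ q ⟧ₚ ⁻¹ * ⟦ q′ ⟧ₚ ⁻¹)     ≈⟨ solve 4 (λ a b u v → a :* b :* (u :* v) := a :* u :* (b :* v)) refl _ _ _ _ ⟩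
        ⟦ p , q ⟧f * ⟦ p′ , q′ ⟧f                      ∎

    ⟦complement⟧ : ∀ q → ⟦ complement q ⟧ₛ ≈ 1# - ⟦ q ⟧ₚ * ⟦ q ⟧ₚ ⁻¹
    ⟦complement⟧ q = begin
      1# * 1# ⁻¹ + (- Q * Q ⁻¹ + 0#)   ≈⟨ +-congʳ (*-congˡ 1⁻¹≈1) ⟩
      1# * 1# + (- Q * Q ⁻¹ + 0#)      ≈⟨ solve 2 (λ Q U → con (1 , 0) :* con (1 , 0) :+ (:- Q :* U :+ con (0 , 0)) := con (1 , 0) :- Q :* U) refl Q (Q ⁻¹) ⟩
      1# - Q * Q ⁻¹                    ∎
      where Q = ⟦ q ⟧ₚ

    ⟦invert⟧ : ∀ c P F → ⟦ invert c P F ⟧ₛ ≈ (⟦ P ⟧ₚ + ⟦ c ⟧ₚ * ⟦ F ⟧ₛ) ⁻¹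
    ⟦invert⟧ c P [] = begin
      1# * ⟦ P ⟧ₚ ⁻¹ + 0#              ≈⟨ trans (+-identityʳ _) (*-identityˡ _) ⟩
      ⟦ P ⟧ₚ ⁻¹                        ≈⟨ ⁻¹-cong (solve 2 (λ P c → P := P :+ c :* con (0 , 0)) refl _ _) ⟩
      (⟦ P ⟧ₚ + ⟦ c ⟧ₚ * 0#) ⁻¹         ∎
    ⟦invert⟧ c P ((p , q) ∷ F) = begin
      ⟦ scale q I₁ ++ complement q ⊗ₛ I₂ ⟧ₛ                  ≈⟨ ⟦++⟧ (scale q I₁) (complement q ⊗ₛ I₂) ⟩
      ⟦ scale q I₁ ⟧ₛ + ⟦ complement q ⊗ₛ I₂ ⟧ₛ              ≈⟨ +-cong (⟦scale⟧ q I₁) (⟦⊗ₛ⟧ (complement q) I₂) ⟩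
      Q * ⟦ I₁ ⟧ₛ + ⟦ complement q ⟧ₛ * ⟦ I₂ ⟧ₛ               ≈⟨ +-cong (*-congˡ (⟦invert⟧ (c ⊠ q) (P ⊠ q ⊞ c ⊠ p) F))
                                                                         (*-cong (⟦complement⟧ q) (⟦invert⟧ c P F)) ⟩
      Q * (P′ * Q + C * p′ + C * Q * E) ⁻¹ + (1# - Q * Q ⁻¹) * (P′ + C * E) ⁻¹
        ≈⟨ +-congʳ (*-congˡ (⁻¹-cong (solve 5 (λ P q c p e → P :* q :+ c :* p :+ c :* q :* e := c :* p :+ q :* (P :+ c :* e)) refl P′ Q C p′ E))) ⟩
      Q * (C * p′ + Q * (P′ + C * E)) ⁻¹ + (1# - Q * Q ⁻¹) * (P′ + C * E) ⁻¹
        ≈⟨ [aq⁻¹+b]⁻¹≈q[a+qb]⁻¹+[1-qq⁻¹]b⁻¹ (C * p′) Q (P′ + C * E) ⟨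
      (C * p′ * Q ⁻¹ + (P′ + C * E)) ⁻¹
        ≈⟨ ⁻¹-cong (solve 5 (λ P c p u e → c :* p :* u :+ (P :+ c :* e) := P :+ c :* (p :* u :+ e)) refl P′ C p′ (Q ⁻¹) E) ⟩
      (P′ + C * (p′ * Q ⁻¹ + E)) ⁻¹                                    ∎
      where
      I₁ = invert (c ⊠ q) (P ⊠ q ⊞ c ⊠ p) F
      I₂ = invert c P F
      Q  = ⟦ q ⟧ₚ
      P′ = ⟦ P ⟧ₚ
      C  = ⟦ c ⟧ₚ
      p′ = ⟦ p ⟧ₚ
      E  = ⟦ F ⟧ₛ

    ⟦fractions⟧ : ∀ t → ⟦ fractions t ⟧ₛ ≈ eval M ρ t
    ⟦fractions⟧ (var i) = trans (+-identityʳ _) (trans (*-congˡ 1⁻¹≈1) (*-identityʳ _))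
    ⟦fractions⟧ zer     = refl
    ⟦fractions⟧ one     = trans (+-identityʳ _) (trans (*-congˡ 1⁻¹≈1) (*-identityʳ _))
    ⟦fractions⟧ (s ⊕ t) = trans (⟦++⟧ (fractions s) (fractions t)) (+-cong (⟦fractions⟧ s) (⟦fractions⟧ t))
    ⟦fractions⟧ (s ⊗ t) = trans (⟦⊗ₛ⟧ (fractions s) (fractions t)) (*-cong (⟦fractions⟧ s) (⟦fractions⟧ t))
    ⟦fractions⟧ (⊝ s)   = trans (⟦scale⟧ (⊟ 1ₚ) (fractions s)) (trans (-1*x≈-x _) (-‿cong (⟦fractions⟧ s)))
    ⟦fractions⟧ (s ᴵ)   = trans (⟦invert⟧ 1ₚ 0ₚ (fractions s))
                                (⁻¹-cong (trans (+-identityˡ _) (trans (*-identityˡ _) (⟦fractions⟧ s))))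

module RegisterMachine where

  open SumsOfFractions

  Register : Set
  Register = Fin 5

  data Instruction : Set where
    load                 : Register → ℕ → Instruction
    clear unit neg inv   : Register → Instruction
    add mul              : Register → Register → Instruction

  action : Instruction → Action
  action (load r v) = cp (toℕ r) v
  action (clear r)  = set0 (toℕ r)
  action (unit r)   = set1 (toℕ r)
  action (neg r)    = setai (toℕ r)
  action (inv r)    = setmi (toℕ r)
  action (add r r′) = seta (toℕ r) (toℕ r′)
  action (mul r r′) = setm (toℕ r) (toℕ r′)

  target : Instruction → Register
  target (load r v) = r
  target (clear r)  = r
  target (unit r)   = r
  target (neg r)    = r
  target (inv r)    = r
  target (add r r′) = r
  target (mul r r′) = r

  negated : Register → List Instruction → List Instruction
  negated i c = neg i ∷ c ++ neg i ∷ []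

  -- accumulate p i j k s adds p · a_i to a_j; the temporary a_k is restored, the scratch a_s is not.
  accumulate : ∀ {n} → Polynomial n → (i j k s : Register) → List Instruction
  accumulate (input v) i j k s = load s (toℕ v) ∷ mul s i ∷ add j s ∷ []
  accumulate 0ₚ        i j k s = []
  accumulate 1ₚ        i j k s = add j i ∷ []
  accumulate (p ⊞ q)   i j k s = accumulate p i j k s ++ accumulate q i j k s
  accumulate (⊟ p)     i j k s = negated i (accumulate p i j k s)
  accumulate (p ⊠ q)   i j k s = c ++ d ++ negated i c ++ negated k d
    where
    c = accumulate p i k j s
    d = accumulate q k j i s

  record Distinct (i j k s : Register) : Set where
    field
      i≢j : i ≢ j
      i≢k : i ≢ k
      j≢k : j ≢ k
      s≢i : s ≢ i
      s≢j : s ≢ j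
      s≢k : s ≢ k

  a₀ a₁ a₂ a₃ a₄ : Register
  a₀ = # 0
  a₁ = # 1
  a₂ = # 2
  a₃ = # 3
  a₄ = # 4

  distinct₀₂₃₄ : Distinct a₀ a₂ a₃ a₄
  distinct₀₂₃₄ = record { i≢j = λ () ; i≢k = λ () ; j≢k = λ () ; s≢i = λ () ; s≢j = λ () ; s≢k = λ () }

  distinct₂₁₃₄ : Distinct a₂ a₁ a₃ a₄
  distinct₂₁₃₄ = record { i≢j = λ () ; i≢k = λ () ; j≢k = λ () ; s≢i = λ () ; s≢j = λ () ; s≢k = λ () }

  -- a₀ holds 1 and a₁ collects the sum; a₂ receives the inverted denominator.
  fractionCode : ∀ {n} → Fraction n → List Instruction
  fractionCode (p , q) = clear a₂ ∷ accumulate q a₀ a₂ a₃ a₄ ++ inv a₂ ∷ accumulate p a₂ a₁ a₃ a₄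

  -- Clearing a₂, a₃ and a₄ does not matter for the value; it makes every register occur.
  prologue : List Instruction
  prologue = clear a₂ ∷ clear a₃ ∷ clear a₄ ∷ unit a₀ ∷ clear a₁ ∷ []

  program : ∀ {n} → FractionSum n → List Instruction
  program F = prologue ++ concatMap fractionCode F

  toThread : List Instruction → Thread
  toThread = foldr (λ x T → action x ∘ₜ T) (ycp (toℕ a₁) ∘ₜ S)

  toThread-testFree : ∀ code → TestFree (toThread code)
  toThread-testFree []         = ∘-tf _ S S-tf
  toThread-testFree (x ∷ code) = ∘-tf _ _ (toThread-testFree code)

  action-registers : ∀ x i → AuxInAction i (action x) → i < 5
  action-registers (load r _) _ (cp-o _)    = toℕ<n r
  action-registers (clear r)  _ set0-o      = toℕ<n r
  action-registers (unit r)   _ set1-o      = toℕ<n r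
  action-registers (neg r)    _ setai-o     = toℕ<n r
  action-registers (inv r)    _ setmi-o     = toℕ<n r
  action-registers (add r _)  _ (seta-o₁ _) = toℕ<n r
  action-registers (add _ r)  _ (seta-o₂ _) = toℕ<n r
  action-registers (mul r _)  _ (setm-o₁ _) = toℕ<n r
  action-registers (mul _ r)  _ (setm-o₂ _) = toℕ<n r

  toThread-registers : ∀ code i → AuxInThread i (toThread code) → i < 5
  toThread-registers []         _ (here ycp-o) = toℕ<n a₁
  toThread-registers (x ∷ code) i (here occ)   = action-registers x i occ
  toThread-registers (x ∷ code) i (left occ)   = toThread-registers code i occ
  toThread-registers (x ∷ code) i (right occ)  = toThread-registers code i occ

  prologue-registers : ∀ code i → i < 5 → AuxInThread i (toThread (prologue ++ code))
  prologue-registers _ 0 _ = left (left (left (here set1-o)))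
  prologue-registers _ 1 _ = left (left (left (left (here set0-o))))
  prologue-registers _ 2 _ = here set0-o
  prologue-registers _ 3 _ = left (here set0-o)
  prologue-registers _ 4 _ = left (left (here set0-o))
  prologue-registers _ (suc (suc (suc (suc (suc i))))) (s≤s (s≤s (s≤s (s≤s (s≤s ())))))

  module Execution {c ℓ : Level} (M : Meadow c ℓ) where

    open Meadow M
    open Semantics M

    reg : State → Register → Carrier
    reg σ r = as σ (toℕ r)

    step : Instruction → State → State
    step x = effect (action x)

    exec : List Instruction → State → State
    exec []      σ = σ
    exec (x ∷ c) σ = exec c (step x σ)

    value : Instruction → State → Carrier
    value (load r v) σ = xs σ v
    value (clear r)  σ = 0#
    value (unit r)   σ = 1#
    value (neg r)    σ = - reg σ r
    value (inv r)    σ = reg σ r ⁻¹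
    value (add r r′) σ = reg σ r + reg σ r′
    value (mul r r′) σ = reg σ r * reg σ r′

    step≡update : ∀ x σ → step x σ ≡ st (xs σ) (upd (as σ) (toℕ (target x)) (value x σ)) (yv σ)
    step≡update (load r v) σ = ≡.refl
    step≡update (clear r)  σ = ≡.refl
    step≡update (unit r)   σ = ≡.refl
    step≡update (neg r)    σ = ≡.refl
    step≡update (inv r)    σ = ≡.refl
    step≡update (add r r′) σ = ≡.refl
    step≡update (mul r r′) σ = ≡.refl

    upd-same : ∀ f i v → upd f i v i ≡ v
    upd-same f i v with i ℕ.≟ i
    ... | yes _   = ≡.refl
    ... | no i≢i  = ⊥-elim (i≢i ≡.refl)

    upd-other : ∀ f i v j → j ≢ i → upd f i v j ≡ f j
    upd-other f i v j j≢i with j ℕ.≟ i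
    ... | yes j≡i = ⊥-elim (j≢i j≡i)
    ... | no _    = ≡.refl

    reg-step-target : ∀ x σ → reg (step x σ) (target x) ≈ value x σ
    reg-step-target x σ = reflexive (≡.trans (≡.cong (λ σ′ → reg σ′ (target x)) (step≡update x σ))
                                             (upd-same (as σ) (toℕ (target x)) (value x σ)))

    reg-step-other : ∀ x σ r → r ≢ target x → reg (step x σ) r ≈ reg σ r
    reg-step-other x σ r r≢t = reflexive (≡.trans (≡.cong (λ σ′ → reg σ′ r) (step≡update x σ))
                                                  (upd-other (as σ) _ _ (toℕ r) (r≢t ∘ toℕ-injective)))

    xs-exec : ∀ c σ → xs (exec c σ) ≡ xs σ
    xs-exec []      σ = ≡.refl
    xs-exec (x ∷ c) σ = ≡.trans (xs-exec c (step x σ)) (≡.cong xs (step≡update x σ))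

    exec-++ : ∀ c d σ → exec (c ++ d) σ ≡ exec d (exec c σ)
    exec-++ []      d σ = ≡.refl
    exec-++ (x ∷ c) d σ = exec-++ c d (step x σ)

    module _ {n : ℕ} (ρ : Fin n → Carrier) where

      open Valuation M ρ
      open IntegerSolver commutativeRing
      open import Relation.Binary.Reasoning.Setoid setoid

      InputsAgree : State → Set ℓ
      InputsAgree σ = ∀ v → xs σ (toℕ v) ≈ ρ v

      inputsAgree-exec : ∀ code σ → InputsAgree σ → InputsAgree (exec code σ)
      inputsAgree-exec code σ agree v = trans (reflexive (≡.cong (λ f → f (toℕ v)) (xs-exec code σ))) (agree v)

      record Accumulated (p : Polynomial n) (i j s : Register) (σ σ′ : State) : Set ℓ where
        field
          at-target : reg σ′ j ≈ reg σ j + ⟦ p ⟧ₚ * reg σ i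
          elsewhere : ∀ r → r ≢ j → r ≢ s → reg σ′ r ≈ reg σ r

      record Accumulates (p : Polynomial n) (i j s : Register) (code : List Instruction) : Set (c ⊔ ℓ) where
        field
          run : ∀ σ → InputsAgree σ → Accumulated p i j s σ (exec code σ)

      open Accumulates

      input-accumulates : ∀ v {i j s} → s ≢ i → s ≢ j →
                          Accumulates (input v) i j s (load s (toℕ v) ∷ mul s i ∷ add j s ∷ [])
      input-accumulates v {i} {j} {s} s≢i s≢j .run σ agree = record
        { at-target = begin
            reg σ₃ j                    ≈⟨ reg-step-target (add j s) σ₂ ⟩
            reg σ₂ j + reg σ₂ s         ≈⟨ +-cong (reg-step-other (mul s i) σ₁ j (≢-sym s≢j)) (reg-step-target (mul s i) σ₁) ⟩
            reg σ₁ j + reg σ₁ s * reg σ₁ i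
              ≈⟨ +-cong (reg-step-other (load s _) σ j (≢-sym s≢j))
                        (*-cong (trans (reg-step-target (load s _) σ) (agree v)) (reg-step-other (load s _) σ i (≢-sym s≢i))) ⟩
            reg σ j + ρ v * reg σ i     ∎
        ; elsewhere = λ r r≢j r≢s →
            trans (reg-step-other (add j s) σ₂ r r≢j)
                  (trans (reg-step-other (mul s i) σ₁ r r≢s) (reg-step-other (load s _) σ r r≢s))
        }
        where
        σ₁ = step (load s (toℕ v)) σ
        σ₂ = step (mul s i) σ₁
        σ₃ = step (add j s) σ₂

      0-accumulates : ∀ {i j s} → Accumulates 0ₚ i j s []
      0-accumulates {i} {j} .run σ _ = record
        { at-target = solve 2 (λ J I → J := J :+ con (0 , 0) :* I) refl (reg σ j) (reg σ i)
        ; elsewhere = λ _ _ _ → refl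
        }

      1-accumulates : ∀ {i j s} → Accumulates 1ₚ i j s (add j i ∷ [])
      1-accumulates {i} {j} .run σ _ = record
        { at-target = trans (reg-step-target (add j i) σ) (+-congˡ (sym (*-identityˡ _)))
        ; elsewhere = λ r r≢j _ → reg-step-other (add j i) σ r r≢j
        }

      ++-accumulates : ∀ {p q i j s c d} → i ≢ j → i ≢ s →
                       Accumulates p i j s c → Accumulates q i j s d → Accumulates (p ⊞ q) i j s (c ++ d)
      ++-accumulates {p} {q} {i} {j} {s} {c} {d} i≢j i≢s acc-c acc-d .run σ agree
        rewrite exec-++ c d σ = record
        { at-target = begin
            reg (exec d σ₁) j                                ≈⟨ D.at-target ⟩
            reg σ₁ j + ⟦ q ⟧ₚ * reg σ₁ i                      ≈⟨ +-cong C.at-target (*-congˡ (C.elsewhere i i≢j i≢s)) ⟩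
            reg σ j + ⟦ p ⟧ₚ * reg σ i + ⟦ q ⟧ₚ * reg σ i     ≈⟨ solve 4 (λ J P Q I → J :+ P :* I :+ Q :* I := J :+ (P :+ Q) :* I) refl _ _ _ _ ⟩
            reg σ j + (⟦ p ⟧ₚ + ⟦ q ⟧ₚ) * reg σ i             ∎
        ; elsewhere = λ r r≢j r≢s → trans (D.elsewhere r r≢j r≢s) (C.elsewhere r r≢j r≢s)
        }
        where
        σ₁ = exec c σ
        module C = Accumulated (run acc-c σ agree)
        module D = Accumulated (run acc-d σ₁ (inputsAgree-exec c σ agree))

      negated-accumulates : ∀ {p i j s c} → i ≢ j → i ≢ s →
                            Accumulates p i j s c → Accumulates (⊟ p) i j s (negated i c)
      negated-accumulates {p} {i} {j} {s} {c} i≢j i≢s acc .run σ agree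
        rewrite exec-++ c (neg i ∷ []) (step (neg i) σ) = record
        { at-target = begin
            reg σ₃ j                              ≈⟨ reg-step-other (neg i) σ₂ j (≢-sym i≢j) ⟩
            reg σ₂ j                              ≈⟨ C.at-target ⟩
            reg σ₁ j + ⟦ p ⟧ₚ * reg σ₁ i           ≈⟨ +-cong (reg-step-other (neg i) σ j (≢-sym i≢j)) (*-congˡ (reg-step-target (neg i) σ)) ⟩
            reg σ j + ⟦ p ⟧ₚ * - reg σ i           ≈⟨ solve 3 (λ J P I → J :+ P :* (:- I) := J :+ (:- P) :* I) refl _ _ _ ⟩
            reg σ j + - ⟦ p ⟧ₚ * reg σ i           ∎
        ; elsewhere = elsewhere
        }
        where
        σ₁ = step (neg i) σ
        σ₂ = exec c σ₁
        σ₃ = step (neg i) σ₂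
        module C = Accumulated (run acc σ₁ (inputsAgree-exec (neg i ∷ []) σ agree))

        elsewhere : ∀ r → r ≢ j → r ≢ s → reg σ₃ r ≈ reg σ r
        elsewhere r r≢j r≢s with r Fin.≟ i
        ... | yes ≡.refl = begin
          reg σ₃ i          ≈⟨ reg-step-target (neg i) σ₂ ⟩
          - reg σ₂ i        ≈⟨ -‿cong (C.elsewhere i i≢j i≢s) ⟩
          - reg σ₁ i        ≈⟨ -‿cong (reg-step-target (neg i) σ) ⟩
          - - reg σ i       ≈⟨ solve 1 (λ I → :- (:- I) := I) refl _ ⟩
          reg σ i           ∎
        ... | no r≢i = trans (reg-step-other (neg i) σ₂ r r≢i)
                             (trans (C.elsewhere r r≢j r≢s) (reg-step-other (neg i) σ r r≢i))

      -- The temporary a_k receives p · a_i, which feeds q · (p · a_i) into a_j; running both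
      -- programs again on negated sources restores a_k and cancels the spurious q · a_k.
      ⊠-accumulates : ∀ {p q i j k s c d} → Distinct i j k s →
                      Accumulates p i k s c → Accumulates q k j s d →
                      Accumulates (p ⊠ q) i j s (c ++ d ++ negated i c ++ negated k d)
      ⊠-accumulates {p} {q} {i} {j} {k} {s} {c} {d} distinct acc-c acc-d .run σ agree
        rewrite exec-++ c (d ++ negated i c ++ negated k d) σ
              | exec-++ d (negated i c ++ negated k d) (exec c σ)
              | exec-++ (negated i c) (negated k d) (exec d (exec c σ)) = record
        { at-target = begin
            reg σ₄ j                                   ≈⟨ A₄.at-target ⟩
            reg σ₃ j + - Q * reg σ₃ k                  ≈⟨ +-cong (A₃.elsewhere j j≢k j≢s) (*-congˡ A₃.at-target) ⟩
            reg σ₂ j + - Q * (reg σ₂ k + - P * reg σ₂ i)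
              ≈⟨ +-cong A₂.at-target (*-congˡ (+-cong k₂ (*-congˡ i₂))) ⟩
            reg σ₁ j + Q * reg σ₁ k + - Q * (reg σ₁ k + - P * I)
              ≈⟨ +-cong (+-cong (A₁.elsewhere j j≢k j≢s) (*-congˡ A₁.at-target)) (*-congˡ (+-congʳ A₁.at-target)) ⟩
            J + Q * (K + P * I) + - Q * (K + P * I + - P * I)
              ≈⟨ solve 5 (λ J K I P Q → J :+ Q :* (K :+ P :* I) :+ (:- Q) :* (K :+ P :* I :+ (:- P) :* I) := J :+ P :* Q :* I) refl J K I P Q ⟩
            J + P * Q * I                              ∎
        ; elsewhere = elsewhere
        }
        where
        open Distinct distinct
        i≢s = ≢-sym s≢i
        j≢s = ≢-sym s≢j
        k≢s = ≢-sym s≢k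
        σ₁ = exec c σ
        σ₂ = exec d σ₁
        σ₃ = exec (negated i c) σ₂
        σ₄ = exec (negated k d) σ₃
        agree₁ = inputsAgree-exec c σ agree
        agree₂ = inputsAgree-exec d σ₁ agree₁
        module A₁ = Accumulated (run acc-c σ agree)
        module A₂ = Accumulated (run acc-d σ₁ agree₁)
        module A₃ = Accumulated (run (negated-accumulates i≢k i≢s acc-c) σ₂ agree₂)
        module A₄ = Accumulated (run (negated-accumulates (≢-sym j≢k) k≢s acc-d) σ₃ (inputsAgree-exec (negated i c) σ₂ agree₂))
        P = ⟦ p ⟧ₚ
        Q = ⟦ q ⟧ₚ
        I = reg σ i
        J = reg σ j
        K = reg σ k
        i₂ : reg σ₂ i ≈ I
        i₂ = trans (A₂.elsewhere i i≢j i≢s) (A₁.elsewhere i i≢k i≢s)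
        k₂ : reg σ₂ k ≈ reg σ₁ k
        k₂ = A₂.elsewhere k (≢-sym j≢k) k≢s

        elsewhere : ∀ r → r ≢ j → r ≢ s → reg σ₄ r ≈ reg σ r
        elsewhere r r≢j r≢s with r Fin.≟ k
        ... | yes ≡.refl = begin
          reg σ₄ k                             ≈⟨ A₄.elsewhere k r≢j r≢s ⟩
          reg σ₃ k                             ≈⟨ A₃.at-target ⟩
          reg σ₂ k + - P * reg σ₂ i            ≈⟨ +-cong (trans k₂ A₁.at-target) (*-congˡ i₂) ⟩
          K + P * I + - P * I                  ≈⟨ solve 3 (λ K P I → K :+ P :* I :+ (:- P) :* I := K) refl K P I ⟩
          K                                    ∎
        ... | no r≢k = trans (A₄.elsewhere r r≢j r≢s)
                       (trans (A₃.elsewhere r r≢k r≢s)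
                       (trans (A₂.elsewhere r r≢j r≢s) (A₁.elsewhere r r≢k r≢s)))

      accumulate-correct : ∀ p {i j k s} → Distinct i j k s → Accumulates p i j s (accumulate p i j k s)
      accumulate-correct (input v) d = input-accumulates v (Distinct.s≢i d) (Distinct.s≢j d)
      accumulate-correct 0ₚ        d = 0-accumulates
      accumulate-correct 1ₚ        d = 1-accumulates
      accumulate-correct (p ⊞ q)   d = ++-accumulates (Distinct.i≢j d) (≢-sym (Distinct.s≢i d))
                                         (accumulate-correct p d) (accumulate-correct q d)
      accumulate-correct (⊟ p)     d = negated-accumulates (Distinct.i≢j d) (≢-sym (Distinct.s≢i d))
                                         (accumulate-correct p d)
      accumulate-correct (p ⊠ q)   d = ⊠-accumulates d (accumulate-correct p swap-jk) (accumulate-correct q swap-ik)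
        where
        open Distinct d
        swap-jk : Distinct _ _ _ _
        swap-jk = record { i≢j = i≢k ; i≢k = i≢j ; j≢k = ≢-sym j≢k ; s≢i = s≢i ; s≢j = s≢k ; s≢k = s≢j }
        swap-ik : Distinct _ _ _ _
        swap-ik = record { i≢j = ≢-sym j≢k ; i≢k = ≢-sym i≢k ; j≢k = ≢-sym i≢j ; s≢i = s≢k ; s≢j = s≢j ; s≢k = s≢i }

      record Added (x : Carrier) (σ σ′ : State) : Set ℓ where
        field
          a₀-kept  : reg σ′ a₀ ≈ reg σ a₀
          a₁-added : reg σ′ a₁ ≈ reg σ a₁ + x

      fraction-added : ∀ f σ → InputsAgree σ → reg σ a₀ ≈ 1# → Added ⟦ f ⟧f σ (exec (fractionCode f) σ)
      fraction-added (p , q) σ agree a₀≈1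
        rewrite exec-++ (accumulate q a₀ a₂ a₃ a₄) (inv a₂ ∷ accumulate p a₂ a₁ a₃ a₄) (step (clear a₂) σ) = record
        { a₀-kept  = trans (Nume.elsewhere a₀ (λ ()) (λ ()))
                     (trans (reg-step-other (inv a₂) σ₂ a₀ (λ ()))
                     (trans (Deno.elsewhere a₀ (λ ()) (λ ())) (reg-step-other (clear a₂) σ a₀ (λ ()))))
        ; a₁-added = begin
            reg σ₄ a₁                           ≈⟨ Nume.at-target ⟩
            reg σ₃ a₁ + ⟦ p ⟧ₚ * reg σ₃ a₂       ≈⟨ +-cong a₁-unchanged (*-congˡ (reg-step-target (inv a₂) σ₂)) ⟩
            reg σ a₁ + ⟦ p ⟧ₚ * reg σ₂ a₂ ⁻¹     ≈⟨ +-congˡ (*-congˡ (⁻¹-cong a₂≈q)) ⟩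
            reg σ a₁ + ⟦ p ⟧ₚ * ⟦ q ⟧ₚ ⁻¹         ∎
        }
        where
        σ₁ = step (clear a₂) σ
        σ₂ = exec (accumulate q a₀ a₂ a₃ a₄) σ₁
        σ₃ = step (inv a₂) σ₂
        σ₄ = exec (accumulate p a₂ a₁ a₃ a₄) σ₃
        agree₁ = inputsAgree-exec (clear a₂ ∷ []) σ agree
        module Deno = Accumulated (run (accumulate-correct q distinct₀₂₃₄) σ₁ agree₁)
        module Nume = Accumulated (run (accumulate-correct p distinct₂₁₃₄) σ₃
                                       (inputsAgree-exec (inv a₂ ∷ []) σ₂ (inputsAgree-exec (accumulate q a₀ a₂ a₃ a₄) σ₁ agree₁)))
        a₂≈q : reg σ₂ a₂ ≈ ⟦ q ⟧ₚ
        a₂≈q = begin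
          reg σ₂ a₂                         ≈⟨ Deno.at-target ⟩
          reg σ₁ a₂ + ⟦ q ⟧ₚ * reg σ₁ a₀     ≈⟨ +-cong (reg-step-target (clear a₂) σ) (*-congˡ (trans (reg-step-other (clear a₂) σ a₀ (λ ())) a₀≈1)) ⟩
          0# + ⟦ q ⟧ₚ * 1#                   ≈⟨ trans (+-identityˡ _) (*-identityʳ _) ⟩
          ⟦ q ⟧ₚ                            ∎
        a₁-unchanged : reg σ₃ a₁ ≈ reg σ a₁
        a₁-unchanged = trans (reg-step-other (inv a₂) σ₂ a₁ (λ ()))
                       (trans (Deno.elsewhere a₁ (λ ()) (λ ())) (reg-step-other (clear a₂) σ a₁ (λ ())))

      fractions-added : ∀ F σ → InputsAgree σ → reg σ a₀ ≈ 1# →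
                        Added ⟦ F ⟧ₛ σ (exec (concatMap fractionCode F) σ)
      fractions-added []      σ _ _ = record { a₀-kept = refl ; a₁-added = sym (+-identityʳ _) }
      fractions-added (f ∷ F) σ agree a₀≈1
        rewrite exec-++ (fractionCode f) (concatMap fractionCode F) σ = record
        { a₀-kept  = trans Rest.a₀-kept First.a₀-kept
        ; a₁-added = trans Rest.a₁-added (trans (+-congʳ First.a₁-added) (+-assoc _ _ _))
        }
        where
        σ₁ = exec (fractionCode f) σ
        module First = Added (fraction-added f σ agree a₀≈1)
        module Rest  = Added (fractions-added F σ₁ (inputsAgree-exec (fractionCode f) σ agree) (trans First.a₀-kept a₀≈1))

      program-correct : ∀ F σ → InputsAgree σ → reg (exec (program F) σ) a₁ ≈ ⟦ F ⟧ₛ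
      program-correct F σ agree rewrite exec-++ prologue (concatMap fractionCode F) σ =
        trans Body.a₁-added (trans (+-congʳ (reg-step-target (clear a₁) σ₄)) (+-identityˡ _))
        where
        σ₄ = exec (clear a₂ ∷ clear a₃ ∷ clear a₄ ∷ unit a₀ ∷ []) σ
        a₀≈1 : reg (exec prologue σ) a₀ ≈ 1#
        a₀≈1 = trans (reg-step-other (clear a₁) σ₄ a₀ (λ ())) (reg-step-target (unit a₀) (exec (clear a₂ ∷ clear a₃ ∷ clear a₄ ∷ []) σ))
        module Body = Added (fractions-added F (exec prologue σ) (inputsAgree-exec prologue σ agree) a₀≈1)

    action-not-test : ∀ x → ¬ IsTest (action x)
    action-not-test (load _ _) ()
    action-not-test (clear _)  ()
    action-not-test (unit _)   ()
    action-not-test (neg _)    ()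
    action-not-test (inv _)    ()
    action-not-test (add _ _)  ()
    action-not-test (mul _ _)  ()

    run-toThread : ∀ code σ → Run (toThread code) σ (effect (ycp (toℕ a₁)) (exec code σ))
    run-toThread []       σ = run-assign (λ ()) run-S
    run-toThread (x ∷ code) σ = run-assign (action-not-test x) (run-toThread code (step x σ))

    initial-inputs : ∀ k (m : Fin (suc k) → Carrier) → InputsAgree m (initial k m)
    initial-inputs k m v with toℕ v ℕ.<? suc k
    ... | yes v<1+k = reflexive (≡.cong m (fromℕ<-toℕ v v<1+k))
    ... | no  v≮1+k = ⊥-elim (v≮1+k (toℕ<n v))

mainTheorem6 : (k : ℕ) (t : Term (suc k)) → ComputedBy k 5 t
mainTheorem6 k t = record
  { thread   = toThread code
  ; testFree = toThread-testFree code
  ; uses     = λ i → mk⇔ (toThread-registers code i) (prologue-registers (concatMap fractionCode (fractions t)) i)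
  ; correct  = λ M _ m →
      let open Semantics M using (initial)
          open Execution M
          open Valuation M m
      in _ , run-toThread code (initial k m) ,
         Meadow.trans M (program-correct m (fractions t) (initial k m) (initial-inputs k m)) (⟦fractions⟧ t)
  }
  where
  open SumsOfFractions
  open RegisterMachine
  code = program (fractions t)
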